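{- Let $n\ge 3$ and let $\mathcal{H}(\mathcal{V},\mathcal{E})$ be the associating hypergraph on the Moufang loop $M(D_n,2)$. Then its covering number is $\rho(\mathcal{H})=n+\lceil n/3\rceil$.
   Context: Let $D_n=\langle x,y\mid x^n=y^2=1,\ xy=yx^{ -1}\rangle$ be the dihedral group of order $2n$. The Moufang loop $M(D_n,2)$ is the set $\{(g,\alpha): g\in D_n,\ \alpha\in\mathbb{Z}_2\}$ with the operation $(g_1,\alpha_1)\circ(g_2,\alpha_2)=\big(g_1^{1-\alpha_2}\, g_2^{(-1)^{\alpha_1}}\, g_1^{\alpha_2},\ \alpha_1+\alpha_2\big)$, where $\alpha_i\in\{0,1\}$ are used as integer exponents. The associating hypergraph $\mathcal{H}(\mathcal{V},\mathcal{E})$ has vertex set $\mathcal{V}=M(D_n,2)$, and its hyperedges are the triples of three pairwise distinct elements $a,b,c$, taken in an order $(a,b,c)$, such that $(a\circ b)\circ c=a\circ(b\circ c)$ (a 3-uniform directed hypergraph). The covering number $\rho(\mathcal{H})$ is the minimum number of hyperedges whose union contains every vertex. -}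

module Defs where

open import Data.Nat using (ℕ; zero; suc; _+_; _∸_; _≤_; _<_; z≤n; s≤s; NonZero; >-nonZero)
open import Data.Nat.DivMod using (_mod_; _/_)
open import Data.Nat.Properties using (≤-trans)
open import Data.Fin using (Fin; toℕ)
open import Data.Bool using (Bool; true; false; _xor_)
open import Data.Product using (_×_; _,_; Σ; ∃)
open import Data.List using (List; length)
open import Data.List.Relation.Unary.Any using (Any)
open import Relation.Binary.PropositionalEquality using (_≡_; _≢_)

⌈_/3⌉ : ℕ → ℕ
⌈ n /3⌉ = (n + 2) / 3

module Dihedral (n : ℕ) .{{_ : NonZero n}} where

  -- the element x^i y^b of D_n  (b = true means a factor y)
  D : Set
  D = Fin n × Bool

  _⊕_ : Fin n → Fin n → Fin n
  i ⊕ k = (toℕ i + toℕ k) mod n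

  ⊝_ : Fin n → Fin n
  ⊝ k = (n ∸ toℕ k) mod n

  -- multiplication, using  y x^k = x^{-k} y :
  -- (x^i y^a)(x^k y^b) = x^{i + (-1)^a k} y^{a+b}
  _·_ : D → D → D
  (i , false) · (k , b) = (i ⊕ k , b)
  (i , true)  · (k , b) = (i ⊕ (⊝ k) , true xor b)

  inv : D → D
  inv (i , false) = (⊝ i , false)
  inv (i , true)  = (i , true)

  -- elements of M(D_n,2): (g , α) with α ∈ ℤ₂ (false = 0, true = 1)
  M : Set
  M = D × Bool

  e : D
  e = (0 mod n , false)

  pow : D → Bool → D
  pow g false = e
  pow g true  = g

  sgnPow : D → Bool → D
  sgnPow g false = g
  sgnPow g true  = inv g

  _∘_ : M → M → M
  (g₁ , α₁) ∘ (g₂ , α₂) =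
    (pow g₁ (Data.Bool.not α₂) · sgnPow g₂ α₁) · pow g₁ α₂ , α₁ xor α₂

  IsHyperedge : M → M → M → Set
  IsHyperedge a b c =
    a ≢ b × a ≢ c × b ≢ c × ((a ∘ b) ∘ c ≡ a ∘ (b ∘ c))

  Hyperedge : Set
  Hyperedge = Σ (M × M × M) λ { (a , b , c) → IsHyperedge a b c }

  _∈ₕ_ : M → Hyperedge → Set
  v ∈ₕ ((a , b , c) , _) = (v ≡ a) Data.Sum.⊎ ((v ≡ b) Data.Sum.⊎ (v ≡ c))
    where import Data.Sum

  IsCover : List Hyperedge → Set
  IsCover Es = ∀ (v : M) → Any (v ∈ₕ_) Es

  CoveringNumberIs : ℕ → Set
  CoveringNumberIs k =
    (∃ λ (Es : List Hyperedge) → IsCover Es × length Es ≡ k)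
    × (∀ (Es : List Hyperedge) → IsCover Es → k ≤ length Es)

3≤⇒nonZero : ∀ {n} → 3 ≤ n → NonZero n
3≤⇒nonZero h = >-nonZero (≤-trans (s≤s z≤n) h)

{-# OPTIONS --safe #-}
module Submission where

-- The loop has 4n elements and a hyperedge covers three of them, so every cover has at
-- least ⌈4n/3⌉ = n + ⌈n/3⌉ hyperedges. For the matching cover, split M(Dₙ,2) into the four
-- classes {(xⁱyˢ, α) | i ∈ ℤₙ}. Any three elements of one class associate: for α = 0 this
-- is associativity of Dₙ, and for α = 1 it amounts to c b⁻¹ a = a b⁻¹ c, which holds in
-- each coset of ⟨x⟩. Writing n = r + 3q, every class is cut into q blocks of three
-- consecutive powers of x, and the 4r leftovers are covered by r + ⌈r/3⌉ more hyperedges.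
-- The identity associates in first position with anything, so for r > 0 the blocks start
-- at x¹, leaving the identity free to serve in several of those extra hyperedges.

open import Defs
open import Algebra.Bundles using (AbelianGroup; Group)
open import Algebra.Structures using (IsAbelianGroup; IsGroup)
import Algebra.Properties.AbelianGroup as AbelianGroupProperties
import Algebra.Properties.CommutativeSemigroup as CommutativeSemigroupProperties
import Algebra.Properties.Group as GroupProperties
import Algebra.Properties.Loop as LoopProperties
open import Data.Bool using (Bool; true; false; not)
open import Data.Bool.Properties using (not-involutive)
open import Data.Fin using (Fin; toℕ)
open import Data.Fin.Patterns using (0F; 1F; 2F)
open import Data.Fin.Properties using (toℕ-injective; toℕ-fromℕ<; toℕ<n; 2↔Bool; *↔×; injective⇒≤)
open import Data.List using (List; []; _∷_; _++_; length; applyUpTo)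
import Data.List as List
open import Data.List.Properties using (length-++; length-applyUpTo)
open import Data.List.Relation.Unary.Any as Any using (Any; here; there)
open import Data.List.Relation.Unary.Any.Properties using (lookup-index; applyUpTo⁺; ++⁺ˡ; ++⁺ʳ)
open import Data.Nat using (ℕ; suc; _+_; _*_; _∸_; _≤_; _<_; z≤n; s≤s; s≤s⁻¹; z<s; NonZero)
open import Data.Nat.DivMod
open import Data.Nat.Divisibility using (divides-refl)
open import Data.Nat.Properties
open import Data.Nat.Tactic.RingSolver using (solve-∀)
open import Data.Product using (_×_; _,_; proj₁; ∃; uncurry)
open import Data.Product.Function.NonDependent.Propositional using (_×-↔_)
open import Data.Sum using (_⊎_; inj₁; inj₂)
open import Function using (_∘′_; _↔_; _↣_; mk↣; Injection)
open import Function.Construct.Composition using (_↔-∘_; _↣-∘_)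
open import Function.Construct.Identity using (↔-id)
open import Function.Properties.Inverse using (↔-sym; ↔⇒↣)
open import Relation.Binary.PropositionalEquality

↣⇒≤ : ∀ {a b} {A : Set a} {B : Set b} {m k} → Fin m ↔ A → A ↣ B → B ↔ Fin k → m ≤ k
↣⇒≤ Fin↔A A↣B B↔Fin = injective⇒≤ (Injection.injective (↔⇒↣ B↔Fin ↣-∘ (A↣B ↣-∘ ↔⇒↣ Fin↔A)))

⌈m+k*3/3⌉≡⌈m/3⌉+k : ∀ m k → ⌈ m + k * 3 /3⌉ ≡ ⌈ m /3⌉ + k
⌈m+k*3/3⌉≡⌈m/3⌉+k m k = begin
  (m + k * 3 + 2) / 3       ≡⟨ cong (_/ 3) (xy∙z≈xz∙y m (k * 3) 2) ⟩
  (m + 2 + k * 3) / 3       ≡⟨ +-distrib-/-∣ʳ (m + 2) (divides-refl k) ⟩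
  (m + 2) / 3 + k * 3 / 3   ≡⟨ cong ((m + 2) / 3 +_) (m*n/n≡m k 3) ⟩
  ⌈ m /3⌉ + k               ∎
  where
  open ≡-Reasoning
  open CommutativeSemigroupProperties +-commutativeSemigroup using (xy∙z≈xz∙y)

n*2*2≤L*3⇒n+⌈n/3⌉≤L : ∀ n L → n * 2 * 2 ≤ L * 3 → n + ⌈ n /3⌉ ≤ L
n*2*2≤L*3⇒n+⌈n/3⌉≤L n L n*2*2≤L*3 = begin
  n + ⌈ n /3⌉       ≡⟨ +-comm n ⌈ n /3⌉ ⟩
  ⌈ n /3⌉ + n       ≡⟨ ⌈m+k*3/3⌉≡⌈m/3⌉+k n n ⟨
  ⌈ n + n * 3 /3⌉   ≡⟨ cong ⌈_/3⌉ (n+n*3≡n*2*2 n) ⟩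
  ⌈ n * 2 * 2 /3⌉   ≤⟨ /-monoˡ-≤ 3 (+-monoˡ-≤ 2 n*2*2≤L*3) ⟩
  ⌈ L * 3 /3⌉       ≡⟨ ⌈m+k*3/3⌉≡⌈m/3⌉+k 0 L ⟩
  L                 ∎
  where
  open ≤-Reasoning
  n+n*3≡n*2*2 : ∀ n → n + n * 3 ≡ n * 2 * 2
  n+n*3≡n*2*2 = solve-∀

module _ (n : ℕ) .{{_ : NonZero n}} where
  open Dihedral n

  toℕ-mod : ∀ m → toℕ (m mod n) ≡ m % n
  toℕ-mod m = toℕ-fromℕ< (m%n<n m n)

  mod-cong : ∀ {a b} → a % n ≡ b % n → a mod n ≡ b mod n
  mod-cong {a} {b} eq = toℕ-injective (trans (toℕ-mod a) (trans eq (sym (toℕ-mod b))))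

  toℕ-mod-cancel : ∀ (i : Fin n) → toℕ i mod n ≡ i
  toℕ-mod-cancel i = toℕ-injective (trans (toℕ-mod (toℕ i)) (m<n⇒m%n≡m (toℕ<n i)))

  mod-+-homo : ∀ a b → (a + b) mod n ≡ (a mod n) ⊕ (b mod n)
  mod-+-homo a b = mod-cong (trans (%-distribˡ-+ a b n)
    (sym (cong₂ (λ x y → (x + y) % n) (toℕ-mod a) (toℕ-mod b))))

  ⊕-assoc : ∀ i j k → (i ⊕ j) ⊕ k ≡ i ⊕ (j ⊕ k)
  ⊕-assoc i j k = begin
    (i ⊕ j) ⊕ k                          ≡⟨ cong ((i ⊕ j) ⊕_) (toℕ-mod-cancel k) ⟨
    (i ⊕ j) ⊕ (toℕ k mod n)              ≡⟨ mod-+-homo (toℕ i + toℕ j) (toℕ k) ⟨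
    (toℕ i + toℕ j + toℕ k) mod n        ≡⟨ cong (_mod n) (+-assoc (toℕ i) (toℕ j) (toℕ k)) ⟩
    (toℕ i + (toℕ j + toℕ k)) mod n      ≡⟨ mod-+-homo (toℕ i) (toℕ j + toℕ k) ⟩
    (toℕ i mod n) ⊕ (j ⊕ k)              ≡⟨ cong (_⊕ (j ⊕ k)) (toℕ-mod-cancel i) ⟩
    i ⊕ (j ⊕ k)                          ∎
    where open ≡-Reasoning

  ⊕-comm : ∀ i j → i ⊕ j ≡ j ⊕ i
  ⊕-comm i j = cong (_mod n) (+-comm (toℕ i) (toℕ j))

  ⊕-identityˡ : ∀ i → (0 mod n) ⊕ i ≡ i
  ⊕-identityˡ i = begin
    (0 mod n) ⊕ i              ≡⟨ cong ((0 mod n) ⊕_) (toℕ-mod-cancel i) ⟨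
    (0 mod n) ⊕ (toℕ i mod n)  ≡⟨ mod-+-homo 0 (toℕ i) ⟨
    toℕ i mod n                ≡⟨ toℕ-mod-cancel i ⟩
    i                          ∎
    where open ≡-Reasoning

  ⊕-inverseˡ : ∀ i → (⊝ i) ⊕ i ≡ 0 mod n
  ⊕-inverseˡ i = begin
    (⊝ i) ⊕ i                              ≡⟨ cong ((⊝ i) ⊕_) (toℕ-mod-cancel i) ⟨
    ((n ∸ toℕ i) mod n) ⊕ (toℕ i mod n)    ≡⟨ mod-+-homo (n ∸ toℕ i) (toℕ i) ⟨
    (n ∸ toℕ i + toℕ i) mod n              ≡⟨ cong (_mod n) (m∸n+n≡m (<⇒≤ (toℕ<n i))) ⟩
    n mod n                                ≡⟨ mod-cong ([m+n]%n≡m%n 0 n) ⟩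
    0 mod n                                ∎
    where open ≡-Reasoning

  ⊕-⊝-isAbelianGroup : IsAbelianGroup _≡_ _⊕_ (0 mod n) ⊝_
  ⊕-⊝-isAbelianGroup = record
    { isGroup = record
      { isMonoid = record
        { isSemigroup = record
          { isMagma = record { isEquivalence = isEquivalence ; ∙-cong = cong₂ _⊕_ }
          ; assoc = ⊕-assoc
          }
        ; identity = ⊕-identityˡ , λ i → trans (⊕-comm i _) (⊕-identityˡ i)
        }
      ; inverse = ⊕-inverseˡ , λ i → trans (⊕-comm i _) (⊕-inverseˡ i)
      ; ⁻¹-cong = cong ⊝_
      }
    ; comm = ⊕-comm
    }

  ⊕-⊝-abelianGroup : AbelianGroup _ _
  ⊕-⊝-abelianGroup = record { isAbelianGroup = ⊕-⊝-isAbelianGroup }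

  private
    module ℤₙ where
      open AbelianGroupProperties ⊕-⊝-abelianGroup public
        using (⁻¹-∙-comm; ⁻¹-anti-homo‿-; ε⁻¹≈ε; loop)
      open CommutativeSemigroupProperties (AbelianGroup.commutativeSemigroup ⊕-⊝-abelianGroup) public
        using (x∙yz≈z∙yx; x∙yz≈y∙xz)
      open LoopProperties loop public using (identityˡ-unique)

  ·-assoc : ∀ g h k → (g · h) · k ≡ g · (h · k)
  ·-assoc (i , false) (j , false) (k , u) = cong (_, u) (⊕-assoc i j k)
  ·-assoc (i , false) (j , true)  (k , u) = cong (_, not u) (⊕-assoc i j (⊝ k))
  ·-assoc (i , true)  (j , false) (k , u) = cong (_, not u) (begin
    (i ⊕ (⊝ j)) ⊕ (⊝ k)    ≡⟨ ⊕-assoc i (⊝ j) (⊝ k) ⟩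
    i ⊕ ((⊝ j) ⊕ (⊝ k))    ≡⟨ cong (i ⊕_) (ℤₙ.⁻¹-∙-comm j k) ⟩
    i ⊕ (⊝ (j ⊕ k))        ∎)
    where open ≡-Reasoning
  ·-assoc (i , true)  (j , true)  (k , u) = cong₂ _,_ (begin
    (i ⊕ (⊝ j)) ⊕ k        ≡⟨ ⊕-assoc i (⊝ j) k ⟩
    i ⊕ ((⊝ j) ⊕ k)        ≡⟨ cong (i ⊕_) (⊕-comm (⊝ j) k) ⟩
    i ⊕ (k ⊕ (⊝ j))        ≡⟨ cong (i ⊕_) (ℤₙ.⁻¹-anti-homo‿- j k) ⟨
    i ⊕ (⊝ (j ⊕ (⊝ k)))    ∎) (sym (not-involutive u))
    where open ≡-Reasoning

  ·-identityˡ : ∀ g → e · g ≡ g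
  ·-identityˡ (i , b) = cong (_, b) (⊕-identityˡ i)

  ·-identityʳ : ∀ g → g · e ≡ g
  ·-identityʳ (i , false) = cong (_, false) (trans (⊕-comm i _) (⊕-identityˡ i))
  ·-identityʳ (i , true)  = cong (_, true) (begin
    i ⊕ (⊝ (0 mod n))   ≡⟨ cong (i ⊕_) ℤₙ.ε⁻¹≈ε ⟩
    i ⊕ (0 mod n)       ≡⟨ ⊕-comm i _ ⟩
    (0 mod n) ⊕ i       ≡⟨ ⊕-identityˡ i ⟩
    i                   ∎)
    where open ≡-Reasoning

  ·-inverseˡ : ∀ g → inv g · g ≡ e
  ·-inverseˡ (i , false) = cong (_, false) (⊕-inverseˡ i)
  ·-inverseˡ (i , true)  = cong (_, false) (trans (⊕-comm i _) (⊕-inverseˡ i))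

  ·-inverseʳ : ∀ g → g · inv g ≡ e
  ·-inverseʳ (i , false) = cong (_, false) (trans (⊕-comm i _) (⊕-inverseˡ i))
  ·-inverseʳ (i , true)  = ·-inverseˡ (i , true)

  ·-inv-isGroup : IsGroup _≡_ _·_ e inv
  ·-inv-isGroup = record
    { isMonoid = record
      { isSemigroup = record
        { isMagma = record { isEquivalence = isEquivalence ; ∙-cong = cong₂ _·_ }
        ; assoc = ·-assoc
        }
      ; identity = ·-identityˡ , ·-identityʳ
      }
    ; inverse = ·-inverseˡ , ·-inverseʳ
    ; ⁻¹-cong = cong inv
    }

  dihedralGroup : Group _ _
  dihedralGroup = record { isGroup = ·-inv-isGroup }

  private
    module Dₙ = GroupProperties dihedralGroup

  ∘-even-even : ∀ g h → (g , false) ∘ (h , false) ≡ (g · h , false)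
  ∘-even-even g h = cong (_, false) (·-identityʳ (g · h))

  ∘-even-odd : ∀ g h → (g , false) ∘ (h , true) ≡ (h · g , true)
  ∘-even-odd g h = cong (λ x → (x · g , true)) (·-identityˡ h)

  ∘-odd-even : ∀ g h → (g , true) ∘ (h , false) ≡ (g · inv h , true)
  ∘-odd-even g h = cong (_, true) (·-identityʳ (g · inv h))

  ∘-odd-odd : ∀ g h → (g , true) ∘ (h , true) ≡ (inv h · g , false)
  ∘-odd-odd g h = cong (λ x → (x · g , false)) (·-identityˡ (inv h))

  eM : M
  eM = (e , false)

  ∘-identityˡ : ∀ v → eM ∘ v ≡ v
  ∘-identityˡ (h , false) = trans (∘-even-even e h) (cong (_, false) (·-identityˡ h))
  ∘-identityˡ (h , true)  = trans (∘-even-odd e h) (cong (_, true) (·-identityʳ h))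

  Associates : M → M → M → Set
  Associates a b c = (a ∘ b) ∘ c ≡ a ∘ (b ∘ c)

  associates-identity : ∀ b c → Associates eM b c
  associates-identity b c = trans (cong (_∘ c) (∘-identityˡ b)) (sym (∘-identityˡ (b ∘ c)))

  associates-even : ∀ g h k → Associates (g , false) (h , false) (k , false)
  associates-even g h k = begin
    ((g , false) ∘ (h , false)) ∘ (k , false)   ≡⟨ cong (_∘ (k , false)) (∘-even-even g h) ⟩
    (g · h , false) ∘ (k , false)               ≡⟨ ∘-even-even (g · h) k ⟩
    ((g · h) · k , false)                       ≡⟨ cong (_, false) (·-assoc g h k) ⟩
    (g · (h · k) , false)                       ≡⟨ ∘-even-even g (h · k) ⟨
    (g , false) ∘ (h · k , false)               ≡⟨ cong ((g , false) ∘_) (∘-even-even h k) ⟨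
    (g , false) ∘ ((h , false) ∘ (k , false))   ∎
    where open ≡-Reasoning

  associates-odd : ∀ g h k → k · (inv h · g) ≡ g · (inv h · k) → Associates (g , true) (h , true) (k , true)
  associates-odd g h k swap = begin
    ((g , true) ∘ (h , true)) ∘ (k , true)   ≡⟨ cong (_∘ (k , true)) (∘-odd-odd g h) ⟩
    (inv h · g , false) ∘ (k , true)         ≡⟨ ∘-even-odd (inv h · g) k ⟩
    (k · (inv h · g) , true)                 ≡⟨ cong (_, true) swap ⟩
    (g · (inv h · k) , true)                 ≡⟨ cong (λ x → (g · x , true)) inv[inv[k]·h]≡inv[h]·k ⟨
    (g · inv (inv k · h) , true)             ≡⟨ ∘-odd-even g (inv k · h) ⟨
    (g , true) ∘ (inv k · h , false)         ≡⟨ cong ((g , true) ∘_) (∘-odd-odd h k) ⟨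
    (g , true) ∘ ((h , true) ∘ (k , true))   ∎
    where
    open ≡-Reasoning
    inv[inv[k]·h]≡inv[h]·k : inv (inv k · h) ≡ inv h · k
    inv[inv[k]·h]≡inv[h]·k = trans (Dₙ.⁻¹-anti-homo-∙ (inv k) h) (cong (inv h ·_) (Dₙ.⁻¹-involutive k))

  sameCoset-swap : ∀ s i j k → (k , s) · (inv (j , s) · (i , s)) ≡ (i , s) · (inv (j , s) · (k , s))
  sameCoset-swap false i j k = cong (_, false) (ℤₙ.x∙yz≈z∙yx k (⊝ j) i)
  sameCoset-swap true  i j k = cong (_, true) (begin
    k ⊕ (⊝ (j ⊕ (⊝ i)))   ≡⟨ cong (k ⊕_) (ℤₙ.⁻¹-anti-homo‿- j i) ⟩
    k ⊕ (i ⊕ (⊝ j))       ≡⟨ ℤₙ.x∙yz≈y∙xz k i (⊝ j) ⟩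
    i ⊕ (k ⊕ (⊝ j))       ≡⟨ cong (i ⊕_) (ℤₙ.⁻¹-anti-homo‿- j k) ⟨
    i ⊕ (⊝ (j ⊕ (⊝ k)))   ∎)
    where open ≡-Reasoning

  associates-sameCoset : ∀ s α i j k → Associates ((i , s) , α) ((j , s) , α) ((k , s) , α)
  associates-sameCoset s false i j k = associates-even _ _ _
  associates-sameCoset s true  i j k = associates-odd _ _ _ (sameCoset-swap s i j k)

  Fin↔M : Fin (n * 2 * 2) ↔ M
  Fin↔M = (((↔-id (Fin n) ×-↔ 2↔Bool) ↔-∘ *↔×) ×-↔ 2↔Bool) ↔-∘ *↔×

  vertexAt : Hyperedge → Fin 3 → M
  vertexAt ((a , _ , _) , _) 0F = a
  vertexAt ((_ , b , _) , _) 1F = b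
  vertexAt ((_ , _ , c) , _) 2F = c

  slot : ∀ {v} (E : Hyperedge) → v ∈ₕ E → Fin 3
  slot _ (inj₁ _)        = 0F
  slot _ (inj₂ (inj₁ _)) = 1F
  slot _ (inj₂ (inj₂ _)) = 2F

  vertexAt-slot : ∀ {v} (E : Hyperedge) (v∈E : v ∈ₕ E) → vertexAt E (slot E v∈E) ≡ v
  vertexAt-slot _ (inj₁ refl)        = refl
  vertexAt-slot _ (inj₂ (inj₁ refl)) = refl
  vertexAt-slot _ (inj₂ (inj₂ refl)) = refl

  cover↣slots : ∀ {Es} → IsCover Es → M ↣ (Fin (length Es) × Fin 3)
  cover↣slots {Es} cover = mk↣ {to = position} position-injective
    where
    position : M → Fin (length Es) × Fin 3
    position v = Any.index (cover v) , slot _ (lookup-index (cover v))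

    vertexAt-position : ∀ v → uncurry (vertexAt ∘′ List.lookup Es) (position v) ≡ v
    vertexAt-position v = vertexAt-slot _ (lookup-index (cover v))

    position-injective : ∀ {v w} → position v ≡ position w → v ≡ w
    position-injective {v} {w} eq =
      trans (sym (vertexAt-position v)) (trans (cong (uncurry (vertexAt ∘′ List.lookup Es)) eq) (vertexAt-position w))

  covering-number-≥ : ∀ Es → IsCover Es → n + ⌈ n /3⌉ ≤ length Es
  covering-number-≥ Es cover =
    n*2*2≤L*3⇒n+⌈n/3⌉≤L n (length Es) (↣⇒≤ Fin↔M (cover↣slots cover) (↔-sym *↔×))

  vertex : Bool → Bool → ℕ → M
  vertex s α m = ((m mod n , s) , α)

  vertex-≢ : ∀ s α m {d} → 0 < d → d < n → vertex s α m ≢ vertex s α (d + m)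
  vertex-≢ s α m {d} 0<d d<n eq = <⇒≢ 0<d (sym d≡0)
    where
    open ≡-Reasoning
    d⊕m≡m : (d mod n) ⊕ (m mod n) ≡ m mod n
    d⊕m≡m = trans (sym (mod-+-homo d m)) (sym (cong (proj₁ ∘′ proj₁) eq))
    d≡0 : d ≡ 0
    d≡0 = begin
      d                ≡⟨ m<n⇒m%n≡m d<n ⟨
      d % n            ≡⟨ toℕ-mod d ⟨
      toℕ (d mod n)    ≡⟨ cong toℕ (ℤₙ.identityˡ-unique _ _ d⊕m≡m) ⟩
      toℕ (0 mod n)    ≡⟨ toℕ-mod 0 ⟩
      0 % n            ≡⟨ m<n⇒m%n≡m (<-trans 0<d d<n) ⟩
      0                ∎

  isCover-fromIndices : ∀ {Es} → (∀ s α m → m < n → Any (vertex s α m ∈ₕ_) Es) → IsCover Es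
  isCover-fromIndices {Es} covers ((i , s) , α) =
    subst (λ j → Any (((j , s) , α) ∈ₕ_) Es) (toℕ-mod-cancel i) (covers s α (toℕ i) (toℕ<n i))

  CoverOfSize : ℕ → Set
  CoverOfSize k = ∃ λ Es → IsCover Es × length Es ≡ k

  identityEdge : ∀ b c → eM ≢ b → eM ≢ c → b ≢ c → Hyperedge
  identityEdge b c eM≢b eM≢c b≢c = (eM , b , c) , eM≢b , eM≢c , b≢c , associates-identity b c

  module _ (3≤n : 3 ≤ n) where

    block : Bool → Bool → ℕ → Hyperedge
    block s α b = (vertex s α b , vertex s α (1 + b) , vertex s α (2 + b)) ,
      vertex-≢ s α b z<s (<⇒≤ 3≤n) , vertex-≢ s α b (s≤s z≤n) 3≤n ,
      vertex-≢ s α (1 + b) z<s (<⇒≤ 3≤n) , associates-sameCoset s α _ _ _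

    block-∋ : ∀ s α b r → r < 3 → vertex s α (r + b) ∈ₕ block s α b
    block-∋ s α b 0 _ = inj₁ refl
    block-∋ s α b 1 _ = inj₂ (inj₁ refl)
    block-∋ s α b 2 _ = inj₂ (inj₂ refl)
    block-∋ s α b (suc (suc (suc _))) (s≤s (s≤s (s≤s ())))

    blocks : Bool → Bool → ℕ → ℕ → List Hyperedge
    blocks s α o q = applyUpTo (λ t → block s α (o + t * 3)) q

    blocks-cover : ∀ s α o q j → j < q * 3 → Any (vertex s α (o + j) ∈ₕ_) (blocks s α o q)
    blocks-cover s α o q j j<q*3 = applyUpTo⁺ _ j∈block (m<n*o⇒m/o<n j<q*3)
      where
      open CommutativeSemigroupProperties +-commutativeSemigroup using (x∙yz≈y∙xz)
      o+j≡[j%3]+[o+[j/3]*3] : o + j ≡ j % 3 + (o + j / 3 * 3)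
      o+j≡[j%3]+[o+[j/3]*3] = trans (cong (o +_) (m≡m%n+[m/n]*n j 3)) (x∙yz≈y∙xz o (j % 3) (j / 3 * 3))
      j∈block : vertex s α (o + j) ∈ₕ block s α (o + j / 3 * 3)
      j∈block = subst (λ x → vertex s α x ∈ₕ block s α (o + j / 3 * 3)) (sym o+j≡[j%3]+[o+[j/3]*3]) (block-∋ s α _ (j % 3) (m%n<n j 3))

    base : ℕ → ℕ → List Hyperedge
    base o q = blocks false false o q ++ blocks true false o q ++ blocks false true o q ++ blocks true true o q

    base-cover : ∀ o q s α j → j < q * 3 → Any (vertex s α (o + j) ∈ₕ_) (base o q)
    base-cover o q false false j j<q*3 = ++⁺ˡ (blocks-cover false false o q j j<q*3)
    base-cover o q true  false j j<q*3 = ++⁺ʳ (blocks false false o q)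
      (++⁺ˡ (blocks-cover true false o q j j<q*3))
    base-cover o q false true  j j<q*3 = ++⁺ʳ (blocks false false o q) (++⁺ʳ (blocks true false o q)
      (++⁺ˡ (blocks-cover false true o q j j<q*3)))
    base-cover o q true  true  j j<q*3 = ++⁺ʳ (blocks false false o q) (++⁺ʳ (blocks true false o q)
      (++⁺ʳ (blocks false true o q) (blocks-cover true true o q j j<q*3)))

    length-blocks++ : ∀ s α o q ys → length (blocks s α o q ++ ys) ≡ q + length ys
    length-blocks++ s α o q ys = trans (length-++ (blocks s α o q)) (cong (_+ length ys) (length-applyUpTo _ q))

    length-base : ∀ o q → length (base o q) ≡ q + (q + (q + q))
    length-base o q =
      trans (length-blocks++ false false o q _) (cong (q +_)
        (trans (length-blocks++ true false o q _) (cong (q +_)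
          (trans (length-blocks++ false true o q _) (cong (q +_)
            (length-applyUpTo _ q))))))

    length-base++ : ∀ r q o extras → n ≡ r + q * 3 → length extras ≡ r + ⌈ r /3⌉ →
                    length (base o q ++ extras) ≡ n + ⌈ n /3⌉
    length-base++ r q o extras n≡r+q*3 length-extras = begin
      length (base o q ++ extras)              ≡⟨ length-++ (base o q) ⟩
      length (base o q) + length extras        ≡⟨ cong₂ _+_ (length-base o q) length-extras ⟩
      q + (q + (q + q)) + (r + ⌈ r /3⌉)        ≡⟨ regroup q r ⌈ r /3⌉ ⟩
      r + q * 3 + (⌈ r /3⌉ + q)                ≡⟨ cong (r + q * 3 +_) (⌈m+k*3/3⌉≡⌈m/3⌉+k r q) ⟨
      r + q * 3 + ⌈ r + q * 3 /3⌉              ≡⟨ cong (λ x → x + ⌈ x /3⌉) n≡r+q*3 ⟨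
      n + ⌈ n /3⌉                              ∎
      where
      open ≡-Reasoning
      regroup : ∀ q r c → q + (q + (q + q)) + (r + c) ≡ r + q * 3 + (c + q)
      regroup = solve-∀

    cover-remainder-0 : ∀ q → n ≡ 0 + q * 3 → CoverOfSize (n + ⌈ n /3⌉)
    cover-remainder-0 q n≡q*3 = base 0 q ++ [] , isCover-fromIndices covers , length-base++ 0 q 0 [] n≡q*3 refl
      where
      covers : ∀ s α m → m < n → Any (vertex s α m ∈ₕ_) (base 0 q ++ [])
      covers s α m m<n = ++⁺ˡ (base-cover 0 q s α m (subst (m <_) n≡q*3 m<n))

    cover-remainder-1 : ∀ q → n ≡ 1 + q * 3 → CoverOfSize (n + ⌈ n /3⌉)
    cover-remainder-1 q n≡1+q*3 = base 1 q ++ extras , isCover-fromIndices covers , length-base++ 1 q 1 extras n≡1+q*3 refl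
      where
      extras : List Hyperedge
      extras = identityEdge (vertex true false 0) (vertex false true 0) (λ ()) (λ ()) (λ ())
             ∷ identityEdge (vertex true true 0) (vertex false true 0) (λ ()) (λ ()) (λ ())
             ∷ []
      covers : ∀ s α m → m < n → Any (vertex s α m ∈ₕ_) (base 1 q ++ extras)
      covers false false 0 _ = ++⁺ʳ (base 1 q) (here (inj₁ refl))
      covers true  false 0 _ = ++⁺ʳ (base 1 q) (here (inj₂ (inj₁ refl)))
      covers false true  0 _ = ++⁺ʳ (base 1 q) (here (inj₂ (inj₂ refl)))
      covers true  true  0 _ = ++⁺ʳ (base 1 q) (there (here (inj₂ (inj₁ refl))))
      covers s α (suc m) m<n = ++⁺ˡ (base-cover 1 q s α m (s≤s⁻¹ (subst (suc m <_) n≡1+q*3 m<n)))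

    cover-remainder-2 : ∀ q → n ≡ 2 + q * 3 → CoverOfSize (n + ⌈ n /3⌉)
    cover-remainder-2 q n≡2+q*3 = base 1 q ++ extras , isCover-fromIndices covers , length-base++ 2 q 1 extras n≡2+q*3 refl
      where
      k : ℕ
      k = 1 + q * 3
      first≢last : ∀ s α → vertex s α 0 ≢ vertex s α k
      first≢last s α = subst (λ x → vertex s α 0 ≢ vertex s α x) (+-identityʳ k)
        (vertex-≢ s α 0 z<s (≤-reflexive (sym n≡2+q*3)))
      extras : List Hyperedge
      extras = ((vertex true false 0 , vertex true false k , vertex false false k) ,
                first≢last true false , (λ ()) , (λ ()) ,
                associates-even (0 mod n , true) (k mod n , true) (k mod n , false))
             ∷ identityEdge (vertex false true 0) (vertex false true k) (λ ()) (λ ()) (first≢last false true)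
             ∷ identityEdge (vertex true true 0) (vertex true true k) (λ ()) (λ ()) (first≢last true true)
             ∷ []
      covers-last : ∀ s α → Any (vertex s α k ∈ₕ_) extras
      covers-last false false = here (inj₂ (inj₂ refl))
      covers-last true  false = here (inj₂ (inj₁ refl))
      covers-last false true  = there (here (inj₂ (inj₂ refl)))
      covers-last true  true  = there (there (here (inj₂ (inj₂ refl))))
      covers : ∀ s α m → m < n → Any (vertex s α m ∈ₕ_) (base 1 q ++ extras)
      covers false false 0 _ = ++⁺ʳ (base 1 q) (there (here (inj₁ refl)))
      covers true  false 0 _ = ++⁺ʳ (base 1 q) (here (inj₁ refl))
      covers false true  0 _ = ++⁺ʳ (base 1 q) (there (here (inj₂ (inj₁ refl))))
      covers true  true  0 _ = ++⁺ʳ (base 1 q) (there (there (here (inj₂ (inj₁ refl)))))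
      covers s α (suc m) m<n = covers-suc s α m (m<1+n⇒m<n∨m≡n (s≤s⁻¹ (subst (suc m <_) n≡2+q*3 m<n)))
        where
        covers-suc : ∀ s α m → m < q * 3 ⊎ m ≡ q * 3 → Any (vertex s α (suc m) ∈ₕ_) (base 1 q ++ extras)
        covers-suc s α m (inj₁ m<q*3) = ++⁺ˡ (base-cover 1 q s α m m<q*3)
        covers-suc s α _ (inj₂ refl)  = ++⁺ʳ (base 1 q) (covers-last s α)

    optimalCover : CoverOfSize (n + ⌈ n /3⌉)
    optimalCover = byRemainder (n % 3) (m%n<n n 3) (m≡m%n+[m/n]*n n 3)
      where
      byRemainder : ∀ r → r < 3 → n ≡ r + n / 3 * 3 → CoverOfSize (n + ⌈ n /3⌉)
      byRemainder 0 _ = cover-remainder-0 (n / 3)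
      byRemainder 1 _ = cover-remainder-1 (n / 3)
      byRemainder 2 _ = cover-remainder-2 (n / 3)
      byRemainder (suc (suc (suc _))) (s≤s (s≤s (s≤s ())))

theorem4p6 : (n : ℕ) (h : 3 ≤ n) →
    Dihedral.CoveringNumberIs n {{3≤⇒nonZero h}} (n + ⌈ n /3⌉)
theorem4p6 n h = optimalCover n {{3≤⇒nonZero h}} h , covering-number-≥ n {{3≤⇒nonZero h}}
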